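{- (i) Let $w$ be a word in $\mathfrak{H}$ and $k$ a positive integer. Then \[ y\,\overline{\sqcup\!\!\sqcup}\,z_kw=\begin{cases} z_1z_k+\sum_{j=0}^{k-2}z_{k-j}z_{j+1}-(k+1)z_{k+1}+z_kz_1 & (w=1),\\[2pt] z_1z_kw+\sum_{j=0}^{k-2}z_{k-j}z_{j+1}w-kz_{k+1}w+z_k\bigl(y\,\overline{\sqcup\!\!\sqcup}\,w\bigr) & (w\ne1),\end{cases} \] where the sum is $0$ when $k=1$. (ii) For all positive integers $k_1,\ldots,k_n$, \[ y\,\overline{\sqcup\!\!\sqcup}\,z_{k_1}z_{k_2}\cdots z_{k_n}=\sum_{i=0}^{n}z_{k_1}\cdots z_{k_i}z_1z_{k_{i+1}}\cdots z_{k_n}+\sum_{\substack{1\le i\le n\\k_i\ge2}}\sum_{j=0}^{k_i-2}z_{k_1}\cdots z_{k_{i-1}}z_{k_i-j}z_{j+1}z_{k_{i+1}}\cdots z_{k_n}-\sum_{i=1}^{n}(k_i+\delta_{ni})\,z_{k_1}\cdots z_{k_{i-1}}z_{k_i+1}z_{k_{i+1}}\cdots z_{k_n}, \] where $\delta_{ni}$ is the Kronecker delta.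
   Context: Let $\mathfrak{H}=\mathbb{Q}\langle x,y\rangle$ be the noncommutative polynomial ring in $x,y$ (juxtaposition is concatenation) and $z_k=x^{k-1}y$ ($k\ge1$). The n-shuffle product $\overline{\sqcup\!\!\sqcup}$ on $\mathfrak{H}$ is the $\mathbb{Q}$-bilinear product defined inductively by $1\,\overline{\sqcup\!\!\sqcup}\,w=w\,\overline{\sqcup\!\!\sqcup}\,1=w$ and $u_1w_1\,\overline{\sqcup\!\!\sqcup}\,u_2w_2=u_1(w_1\,\overline{\sqcup\!\!\sqcup}\,u_2w_2)+u_2(u_1w_1\,\overline{\sqcup\!\!\sqcup}\,w_2)-\delta(w_1)\tau(u_1)u_2w_2-\delta(w_2)\tau(u_2)u_1w_1$ for letters $u_1,u_2\in\{x,y\}$ and words $w,w_1,w_2\in\mathfrak{H}$, where $\delta(w)=1$ if $w=1$ and $0$ otherwise, and $\tau(x)=y$, $\tau(y)=x$. -}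

module Defs where

open import Data.Nat using (ℕ; zero; suc; _∸_; _≤_)
open import Data.Integer using (+_)
open import Data.Rational using (ℚ; 0ℚ; 1ℚ; _+_; _*_; -_; _/_)
open import Data.List using (List; []; _∷_; _++_; map; replicate; concat; concatMap; upTo)
open import Data.Product using (_×_; _,_)
open import Relation.Nullary using (yes; no)
open import Relation.Binary.PropositionalEquality using (_≡_; _≢_)
import Data.List.Properties as LP

data Letter : Set where
  x y : Letter

Word : Set
Word = List Letter

letter-dec : (a b : Letter) → Relation.Nullary.Dec (a ≡ b)
letter-dec x x = yes Relation.Binary.PropositionalEquality.refl
letter-dec x y = no λ ()
letter-dec y x = no λ ()
letter-dec y y = yes Relation.Binary.PropositionalEquality.refl

word-dec : (u v : Word) → Relation.Nullary.Dec (u ≡ v)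
word-dec = LP.≡-dec letter-dec

-- Elements of 𝔥 = ℚ⟨x,y⟩ are represented as finite formal ℚ-linear
-- combinations of words; two representations denote the same polynomial
-- iff all coefficients agree (_≈_ below).
Poly : Set
Poly = List (ℚ × Word)

coeff : Poly → Word → ℚ
coeff [] w = 0ℚ
coeff ((c , v) ∷ p) w with word-dec v w
... | yes _ = c + coeff p w
... | no  _ = coeff p w

infix 4 _≈_
_≈_ : Poly → Poly → Set
p ≈ q = ∀ w → coeff p w ≡ coeff q w

⟦_⟧ : Word → Poly
⟦ w ⟧ = (1ℚ , w) ∷ []

infixl 6 _⊕_ _⊖_
_⊕_ : Poly → Poly → Poly
_⊕_ = _++_

infixr 7 _·_
_·_ : ℚ → Poly → Poly
c · p = map (λ { (d , v) → (c * d , v) }) p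

⊝_ : Poly → Poly
⊝ p = (- 1ℚ) · p

_⊖_ : Poly → Poly → Poly
p ⊖ q = p ⊕ ⊝ q

infixr 8 _◃_
_◃_ : Word → Poly → Poly
u ◃ p = map (λ { (d , v) → (d , u ++ v) }) p

infixl 8 _▹_
_▹_ : Poly → Word → Poly
p ▹ u = map (λ { (d , v) → (d , v ++ u) }) p

Σ : List Poly → Poly
Σ = concat

ℕ→ℚ : ℕ → ℚ
ℕ→ℚ n = + n / 1

τ : Letter → Letter
τ x = y
τ y = x

δ· : Word → Word → Poly
δ· [] t = ⟦ t ⟧
δ· (_ ∷ _) t = []

nsh : Word → Word → Poly
nsh [] v = ⟦ v ⟧
nsh (a ∷ w₁) [] = ⟦ a ∷ w₁ ⟧
nsh (a ∷ w₁) (b ∷ w₂) =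
  ((a ∷ []) ◃ nsh w₁ (b ∷ w₂)) ⊕ ((b ∷ []) ◃ nsh (a ∷ w₁) w₂)
    ⊖ δ· w₁ (τ a ∷ b ∷ w₂) ⊖ δ· w₂ (τ b ∷ a ∷ w₁)

z : ℕ → Word
z k = replicate (k ∸ 1) x ++ (y ∷ [])

-- For a sequence k : ℕ → ℕ (1-based: k 1, k 2, …), zseg k a b = z_{k_a} z_{k_{a+1}} ⋯ z_{k_b}
-- (the empty word 1 when b < a).
zfrom : (ℕ → ℕ) → ℕ → ℕ → Word
zfrom k a zero = []
zfrom k a (suc m) = z (k a) ++ zfrom k (suc a) m

zseg : (ℕ → ℕ) → ℕ → ℕ → Word
zseg k a b = zfrom k a (suc b ∸ a)

Σ< : ℕ → (ℕ → Poly) → Poly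
Σ< n f = Σ (map f (upTo n))

δK : ℕ → ℕ → ℕ
δK m n with m Data.Nat.≟ n
... | yes _ = 1
... | no  _ = 0

module Submission where

open import Defs
open import Data.Nat using (ℕ; zero; suc; _∸_; _≤_; _<_; _+_; z≤n; s≤s)
import Data.Nat as ℕ
import Data.Nat.Properties as ℕP
import Data.Nat.Coprimality as Coprime
open import Data.Integer using (+_)
import Data.Integer as ℤ
import Data.Integer.Properties as ℤP
import Data.Rational as ℚ
open ℚ using (0ℚ; 1ℚ)
import Data.Rational.Properties as ℚP
open import Data.List using ([]; _∷_; _++_; map; concat; upTo)
import Data.List.Properties as LP
open import Data.Product using (_×_; _,_)
open import Data.Empty using (⊥-elim)
open import Function using (_∘_)
open import Relation.Nullary using (Dec; yes; no)
open import Relation.Binary.PropositionalEquality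
open import Relation.Binary.Bundles using (Setoid)
open import Algebra.Bundles using (CommutativeMonoid)
import Algebra.Solver.CommutativeMonoid as CommutativeMonoidSolver

-- Part (i) is the case distinction w = 1 / w ≠ 1 of a single formula valid
-- for every word w and k ≥ 1:
--   y ⧢ z_k w = z₁ z_k w + Σ_{j<k-1} z_{k-j} z_{j+1} w − k z_{k+1} w
--               + z_k (y ⧢ w) − δ(w) z_{k+1}                       (y⧢z)
-- proved by induction on k: unfolding the definition once gives
-- y ⧢ x v = y x v + x (y ⧢ v) − x x v, and x·(formula for k) regroups into the
-- formula for k+1 (the new splitting term is x z₁ z_k = z₂ z_k, and
-- x·(−k z_{k+1} w) − x x v combine into −(k+1) z_{k+2} w).
-- Part (ii) follows from (y⧢z) by induction on n, now starting at n = 0: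
-- with w = z_{k₂} ⋯ z_{kₙ}, every sum on the right-hand side splits into its
-- i = 0 term and z_{k₁} times the same sum for k₂, …, kₙ; the correction
-- −δ(w) z_{k₁+1} is exactly the Kronecker delta δ_{n1}.

ℕ→ℚ-suc : ∀ k → ℕ→ℚ (suc k) ≡ ℕ→ℚ k ℚ.+ 1ℚ
ℕ→ℚ-suc k = trans (ℚP./-cong numerators refl)
  (cong (ℚ._+ 1ℚ) (sym (ℚP.normalize-coprime (Coprime.sym (Coprime.1-coprimeTo k)))))
  where
  numerators : + suc k ≡ + k ℤ.* + 1 ℤ.+ + 1 ℤ.* + 1
  numerators = trans (cong +_ (ℕP.+-comm 1 k)) (cong (ℤ._+ + 1) (sym (ℤP.*-identityʳ (+ k))))

coeff-⊕ : ∀ p q w → coeff (p ⊕ q) w ≡ coeff p w ℚ.+ coeff q w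
coeff-⊕ [] q w = sym (ℚP.+-identityˡ (coeff q w))
coeff-⊕ ((c , v) ∷ p) q w with word-dec v w
... | yes _ = trans (cong (c ℚ.+_) (coeff-⊕ p q w)) (sym (ℚP.+-assoc c _ _))
... | no _ = coeff-⊕ p q w

-- Coefficientwise equality, wrapped in a record so that Agda can recover
-- both polynomials from an equation (the bare function type _≈_ cannot).
infix 4 _≋_
record _≋_ (p q : Poly) : Set where
  constructor coeffwise
  field coeffs : p ≈ q
open _≋_

≡⇒≋ : ∀ {p q} → p ≡ q → p ≋ q
≡⇒≋ refl = coeffwise λ _ → refl

≋-setoid : Setoid _ _
≋-setoid = record
  { Carrier = Poly
  ; _≈_ = _≋_
  ; isEquivalence = record
    { refl = coeffwise λ _ → refl
    ; sym = λ p≋q → coeffwise λ w → sym (coeffs p≋q w)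
    ; trans = λ p≋q q≋r → coeffwise λ w → trans (coeffs p≋q w) (coeffs q≋r w)
    }
  }

open Setoid ≋-setoid using () renaming (refl to ≋-refl; trans to ≋-trans)

⊕-cong : ∀ {p p′ q q′} → p ≋ p′ → q ≋ q′ → p ⊕ q ≋ p′ ⊕ q′
⊕-cong {p} {p′} {q} {q′} p≋p′ q≋q′ = coeffwise λ w → begin
  coeff (p ⊕ q) w             ≡⟨ coeff-⊕ p q w ⟩
  coeff p w ℚ.+ coeff q w     ≡⟨ cong₂ ℚ._+_ (coeffs p≋p′ w) (coeffs q≋q′ w) ⟩
  coeff p′ w ℚ.+ coeff q′ w   ≡⟨ coeff-⊕ p′ q′ w ⟨
  coeff (p′ ⊕ q′) w           ∎
  where open ≡-Reasoning

⊕-congˡ : ∀ p {q q′} → q ≋ q′ → p ⊕ q ≋ p ⊕ q′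
⊕-congˡ p = ⊕-cong (≋-refl {p})

⊕-congʳ : ∀ q {p p′} → p ≋ p′ → p ⊕ q ≋ p′ ⊕ q
⊕-congʳ q p≋p′ = ⊕-cong p≋p′ (≋-refl {q})

⊕-comm : ∀ p q → p ⊕ q ≋ q ⊕ p
⊕-comm p q = coeffwise λ w → trans (coeff-⊕ p q w)
  (trans (ℚP.+-comm (coeff p w) (coeff q w)) (sym (coeff-⊕ q p w)))

⊕-commutativeMonoid : CommutativeMonoid _ _
⊕-commutativeMonoid = record
  { Carrier = Poly ; _≈_ = _≋_ ; _∙_ = _⊕_ ; ε = []
  ; isCommutativeMonoid = record
    { isMonoid = record
      { isSemigroup = record
        { isMagma = record { isEquivalence = Setoid.isEquivalence ≋-setoid ; ∙-cong = ⊕-cong }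
        ; assoc = λ p q r → ≡⇒≋ (LP.++-assoc p q r) }
      ; identity = (λ p → ≋-refl) , (λ p → ≡⇒≋ (LP.++-identityʳ p)) }
    ; comm = ⊕-comm } }

module ⊕-Solver = CommutativeMonoidSolver ⊕-commutativeMonoid

open ⊕-Solver using (solve; _⊜_) renaming (_⊕_ to _⊞_)

coeff-hit : ∀ c t p w → t ≡ w → coeff ((c , t) ∷ p) w ≡ c ℚ.+ coeff p w
coeff-hit c t p w t≡w with word-dec t w
... | yes _ = refl
... | no t≢w = ⊥-elim (t≢w t≡w)

coeff-miss : ∀ c t p w → t ≢ w → coeff ((c , t) ∷ p) w ≡ coeff p w
coeff-miss c t p w t≢w with word-dec t w
... | yes t≡w = ⊥-elim (t≢w t≡w)
... | no _ = refl

merge-like-terms : ∀ a b t → (a , t) ∷ (b , t) ∷ [] ≋ (a ℚ.+ b , t) ∷ []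
merge-like-terms a b t = coeffwise λ w → go w (word-dec t w)
  where
  go : ∀ w → Dec (t ≡ w) → coeff ((a , t) ∷ (b , t) ∷ []) w ≡ coeff ((a ℚ.+ b , t) ∷ []) w
  go w (yes t≡w) = begin
    coeff ((a , t) ∷ (b , t) ∷ []) w ≡⟨ coeff-hit a t _ w t≡w ⟩
    a ℚ.+ coeff ((b , t) ∷ []) w     ≡⟨ cong (a ℚ.+_) (coeff-hit b t [] w t≡w) ⟩
    a ℚ.+ (b ℚ.+ 0ℚ)                 ≡⟨ ℚP.+-assoc a b 0ℚ ⟨
    a ℚ.+ b ℚ.+ 0ℚ                   ≡⟨ coeff-hit (a ℚ.+ b) t [] w t≡w ⟨
    coeff ((a ℚ.+ b , t) ∷ []) w     ∎
    where open ≡-Reasoning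
  go w (no t≢w) = trans (coeff-miss a t _ w t≢w)
    (trans (coeff-miss b t [] w t≢w) (sym (coeff-miss (a ℚ.+ b) t [] w t≢w)))

subtract-once-more : ∀ k t → ⊝ (ℕ→ℚ k · ⟦ t ⟧) ⊖ ⟦ t ⟧ ≋ ⊝ (ℕ→ℚ (suc k) · ⟦ t ⟧)
subtract-once-more k t =
  ≋-trans (merge-like-terms _ _ t) (≡⇒≋ (cong (λ c → (c , t) ∷ []) coefficients))
  where
  open ≡-Reasoning
  coefficients : (ℚ.- 1ℚ) ℚ.* (ℕ→ℚ k ℚ.* 1ℚ) ℚ.+ (ℚ.- 1ℚ) ℚ.* 1ℚ
                   ≡ (ℚ.- 1ℚ) ℚ.* (ℕ→ℚ (suc k) ℚ.* 1ℚ)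
  coefficients = begin
    (ℚ.- 1ℚ) ℚ.* (ℕ→ℚ k ℚ.* 1ℚ) ℚ.+ (ℚ.- 1ℚ) ℚ.* 1ℚ
      ≡⟨ ℚP.*-distribˡ-+ (ℚ.- 1ℚ) (ℕ→ℚ k ℚ.* 1ℚ) 1ℚ ⟨
    (ℚ.- 1ℚ) ℚ.* (ℕ→ℚ k ℚ.* 1ℚ ℚ.+ 1ℚ)
      ≡⟨ cong (λ c → (ℚ.- 1ℚ) ℚ.* (c ℚ.+ 1ℚ)) (ℚP.*-identityʳ (ℕ→ℚ k)) ⟩
    (ℚ.- 1ℚ) ℚ.* (ℕ→ℚ k ℚ.+ 1ℚ)
      ≡⟨ cong ((ℚ.- 1ℚ) ℚ.*_) (ℕ→ℚ-suc k) ⟨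
    (ℚ.- 1ℚ) ℚ.* ℕ→ℚ (suc k)
      ≡⟨ cong ((ℚ.- 1ℚ) ℚ.*_) (ℚP.*-identityʳ (ℕ→ℚ (suc k))) ⟨
    (ℚ.- 1ℚ) ℚ.* (ℕ→ℚ (suc k) ℚ.* 1ℚ)
      ∎

coeff-◃-shift : ∀ a p w → coeff ((a ∷ []) ◃ p) (a ∷ w) ≡ coeff p w
coeff-◃-shift a [] w = refl
coeff-◃-shift a ((c , v) ∷ p) w = by-cases (word-dec v w)
  where
  open ≡-Reasoning
  by-cases : Dec (v ≡ w) → coeff ((c , a ∷ v) ∷ (a ∷ []) ◃ p) (a ∷ w) ≡ coeff ((c , v) ∷ p) w
  by-cases (yes v≡w) = begin
    coeff ((c , a ∷ v) ∷ (a ∷ []) ◃ p) (a ∷ w)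
      ≡⟨ coeff-hit c (a ∷ v) _ (a ∷ w) (cong (a ∷_) v≡w) ⟩
    c ℚ.+ coeff ((a ∷ []) ◃ p) (a ∷ w)         ≡⟨ cong (c ℚ.+_) (coeff-◃-shift a p w) ⟩
    c ℚ.+ coeff p w                            ≡⟨ coeff-hit c v p w v≡w ⟨
    coeff ((c , v) ∷ p) w                      ∎
  by-cases (no v≢w) = begin
    coeff ((c , a ∷ v) ∷ (a ∷ []) ◃ p) (a ∷ w)
      ≡⟨ coeff-miss c (a ∷ v) _ (a ∷ w) (v≢w ∘ LP.∷-injectiveʳ) ⟩
    coeff ((a ∷ []) ◃ p) (a ∷ w)               ≡⟨ coeff-◃-shift a p w ⟩
    coeff p w                                  ≡⟨ coeff-miss c v p w v≢w ⟨
    coeff ((c , v) ∷ p) w                      ∎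

coeff-◃-miss : ∀ a p t → (∀ w → t ≢ a ∷ w) → coeff ((a ∷ []) ◃ p) t ≡ 0ℚ
coeff-◃-miss a [] t _ = refl
coeff-◃-miss a ((c , v) ∷ p) t t≢a∷ =
  trans (coeff-miss c (a ∷ v) _ t (λ a∷v≡t → t≢a∷ v (sym a∷v≡t))) (coeff-◃-miss a p t t≢a∷)

◃-letter-cong : ∀ a {p q} → p ≋ q → (a ∷ []) ◃ p ≋ (a ∷ []) ◃ q
◃-letter-cong a {p} {q} p≋q = coeffwise coefficients
  where
  vanish : ∀ {t} → (∀ w → t ≢ a ∷ w) → coeff ((a ∷ []) ◃ p) t ≡ coeff ((a ∷ []) ◃ q) t
  vanish {t} t≢a∷ = trans (coeff-◃-miss a p t t≢a∷) (sym (coeff-◃-miss a q t t≢a∷))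
  coefficients : (a ∷ []) ◃ p ≈ (a ∷ []) ◃ q
  coefficients [] = vanish λ _ ()
  coefficients (b ∷ w) with letter-dec a b
  ... | yes refl = trans (coeff-◃-shift a p w) (trans (coeffs p≋q w) (sym (coeff-◃-shift a q w)))
  ... | no a≢b = vanish λ _ b∷w≡a∷ → a≢b (sym (LP.∷-injectiveˡ b∷w≡a∷))

[]◃ : ∀ p → [] ◃ p ≡ p
[]◃ [] = refl
[]◃ ((c , v) ∷ p) = cong ((c , v) ∷_) ([]◃ p)

◃-◃ : ∀ u v p → u ◃ (v ◃ p) ≡ (u ++ v) ◃ p
◃-◃ u v [] = refl
◃-◃ u v ((c , t) ∷ p) = cong₂ (λ s q → (c , s) ∷ q) (sym (LP.++-assoc u v t)) (◃-◃ u v p)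

◃-cong : ∀ u {p q} → p ≋ q → u ◃ p ≋ u ◃ q
◃-cong [] {p} {q} p≋q = ≋-trans (≡⇒≋ ([]◃ p)) (≋-trans p≋q (≡⇒≋ (sym ([]◃ q))))
◃-cong (a ∷ u) {p} {q} p≋q = ≋-trans (≡⇒≋ (sym (◃-◃ (a ∷ []) u p)))
  (≋-trans (◃-letter-cong a (◃-cong u p≋q)) (≡⇒≋ (◃-◃ (a ∷ []) u q)))

◃-⊕ : ∀ u p q → u ◃ (p ⊕ q) ≡ u ◃ p ⊕ u ◃ q
◃-⊕ u = LP.map-++ _

⊝-⊕ : ∀ p q → ⊝ (p ⊕ q) ≡ ⊝ p ⊕ ⊝ q
⊝-⊕ = LP.map-++ _

◃-⊝ : ∀ u p → u ◃ ⊝ p ≡ ⊝ (u ◃ p)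
◃-⊝ u [] = refl
◃-⊝ u ((c , v) ∷ p) = cong ((ℚ.- 1ℚ ℚ.* c , u ++ v) ∷_) (◃-⊝ u p)

◃-⊝δ· : ∀ u w t → u ◃ ⊝ δ· w t ≡ ⊝ δ· w (u ++ t)
◃-⊝δ· u [] t = refl
◃-⊝δ· u (_ ∷ _) t = refl

Σ<-head : ∀ n f → Σ< (suc n) f ≡ f 0 ⊕ Σ< n (f ∘ suc)
Σ<-head n f = cong concat
  (trans (LP.map-upTo f (suc n)) (cong (f 0 ∷_) (sym (LP.map-upTo (f ∘ suc) n))))

Σ<-last : ∀ n f → Σ< (suc n) f ≡ Σ< n f ⊕ f n
Σ<-last n f = begin
  concat (map f (upTo (suc n)))           ≡⟨ cong (concat ∘ map f) (LP.upTo-∷ʳ n) ⟨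
  concat (map f (upTo n ++ n ∷ []))       ≡⟨ cong concat (LP.map-++ f (upTo n) (n ∷ [])) ⟩
  concat (map f (upTo n) ++ f n ∷ [])     ≡⟨ LP.concat-++ (map f (upTo n)) (f n ∷ []) ⟨
  Σ< n f ⊕ (f n ⊕ [])                     ≡⟨ cong (Σ< n f ⊕_) (LP.++-identityʳ (f n)) ⟩
  Σ< n f ⊕ f n                            ∎
  where open ≡-Reasoning

Σ<-cong : ∀ n {f g : ℕ → Poly} → (∀ j → j < n → f j ≡ g j) → Σ< n f ≡ Σ< n g
Σ<-cong zero _ = refl
Σ<-cong (suc n) {f} {g} f≡g = begin
  Σ< (suc n) f               ≡⟨ Σ<-head n f ⟩
  f 0 ⊕ Σ< n (f ∘ suc)       ≡⟨ cong₂ _⊕_ (f≡g 0 (s≤s z≤n))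
                                          (Σ<-cong n λ j j<n → f≡g (suc j) (s≤s j<n)) ⟩
  g 0 ⊕ Σ< n (g ∘ suc)       ≡⟨ Σ<-head n g ⟨
  Σ< (suc n) g               ∎
  where open ≡-Reasoning

◃-Σ< : ∀ u n f → u ◃ Σ< n f ≡ Σ< n (λ j → u ◃ f j)
◃-Σ< u n f = LP.map-concatMap _ f (upTo n)

Σ<-◃ : ∀ n {u} f g → (∀ j → j < n → f j ≡ u ◃ g j) → Σ< n f ≡ u ◃ Σ< n g
Σ<-◃ n {u} f g f≡ug = trans (Σ<-cong n f≡ug) (sym (◃-Σ< u n g))

Σ<-peel : ∀ n {u} f g → (∀ j → j < n → f (suc j) ≡ u ◃ g j) → Σ< (suc n) f ≡ f 0 ⊕ u ◃ Σ< n g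
Σ<-peel n f g tail≡ug = trans (Σ<-head n f) (cong (f 0 ⊕_) (Σ<-◃ n (f ∘ suc) g tail≡ug))

z-∸ : ∀ {k j} → j < k → z (suc k ∸ j) ≡ x ∷ z (k ∸ j)
z-∸ {suc k} {zero} _ = refl
z-∸ {suc k} {suc j} (s≤s j<k) = z-∸ j<k

δ·-z : ∀ k w t → δ· (z k ++ w) t ≡ []
δ·-z zero w t = refl
δ·-z (suc zero) w t = refl
δ·-z (suc (suc k)) w t = refl

y⧢_ : Word → Poly
y⧢ w = nsh (y ∷ []) w

splitSum : ℕ → Word → Poly
splitSum k w = Σ< (k ∸ 1) (λ j → ⟦ z (k ∸ j) ++ z (suc j) ++ w ⟧)

y⧢z-expansion : ℕ → Word → Poly
y⧢z-expansion k w =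
  ⟦ z 1 ++ z k ++ w ⟧ ⊕ splitSum k w ⊖ ℕ→ℚ k · ⟦ z (suc k) ++ w ⟧ ⊕ z k ◃ y⧢ w ⊖ δ· w (z (suc k))

splitSum-step : ∀ m w →
  splitSum (suc (suc m)) w ≡ (x ∷ []) ◃ splitSum (suc m) w ⊕ (x ∷ []) ◃ ⟦ z 1 ++ z (suc m) ++ w ⟧
splitSum-step m w = begin
  Σ< (suc m) f
    ≡⟨ Σ<-last m f ⟩
  Σ< m f ⊕ f m
    ≡⟨ cong₂ _⊕_ (Σ<-◃ m f g λ j j<m →
                   cong (λ t → ⟦ t ++ z (suc j) ++ w ⟧) (z-∸ (ℕP.m<n⇒m<1+n j<m)))
                 (cong (λ n → ⟦ z n ++ z (suc m) ++ w ⟧) (ℕP.m+n∸n≡m 2 m)) ⟩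
  X ◃ Σ< m g ⊕ X ◃ ⟦ z 1 ++ z (suc m) ++ w ⟧ ∎
  where
  open ≡-Reasoning
  X : Word
  X = x ∷ []
  f g : ℕ → Poly
  f j = ⟦ z (suc (suc m) ∸ j) ++ z (suc j) ++ w ⟧
  g j = ⟦ z (suc m ∸ j) ++ z (suc j) ++ w ⟧

-- For k = 1 it is the defining recursion of ⧢ up
-- to the order of terms.  For k = m+2, the definition gives
-- y ⧢ x v = y x v + x (y ⧢ v) − x x v with v = z_{m+1} w; the induction
-- hypothesis for y ⧢ v, multiplied by x, regroups into the formula for m+2.
y⧢z : ∀ k → 1 ≤ k → ∀ w → y⧢ (z k ++ w) ≋ y⧢z-expansion k w
y⧢z (suc zero) (s≤s z≤n) w =
  solve 4 (λ a c d e → ((a ⊞ d) ⊞ c) ⊞ e ⊜ (((a ⊞ ⊕-Solver.id) ⊞ c) ⊞ d) ⊞ e) ≋-refl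
    ⟦ y ∷ y ∷ w ⟧ (⊝ ⟦ x ∷ y ∷ w ⟧) ((y ∷ []) ◃ y⧢ w) (⊝ δ· w (x ∷ y ∷ []))
y⧢z (suc (suc m)) (s≤s z≤n) w = begin
  ⟦ y ∷ x ∷ v ⟧ ⊕ X ◃ y⧢ v ⊖ ⟦ x ∷ x ∷ v ⟧ ⊖ δ· v (y ∷ y ∷ [])
    ≡⟨ cong (λ d → ⟦ y ∷ x ∷ v ⟧ ⊕ X ◃ y⧢ v ⊖ ⟦ x ∷ x ∷ v ⟧ ⊖ d) (δ·-z (suc m) w (y ∷ y ∷ [])) ⟩
  ⟦ y ∷ x ∷ v ⟧ ⊕ X ◃ y⧢ v ⊖ ⟦ x ∷ x ∷ v ⟧ ⊕ []
    ≈⟨ ⊕-congʳ [] (⊕-congʳ (⊝ ⟦ x ∷ x ∷ v ⟧) (⊕-congˡ ⟦ y ∷ x ∷ v ⟧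
         (◃-cong X (y⧢z (suc m) (s≤s z≤n) w)))) ⟩
  ⟦ y ∷ x ∷ v ⟧ ⊕ X ◃ y⧢z-expansion (suc m) w ⊖ ⟦ x ∷ x ∷ v ⟧ ⊕ []
    ≡⟨ cong (λ e → ⟦ y ∷ x ∷ v ⟧ ⊕ e ⊖ ⟦ x ∷ x ∷ v ⟧ ⊕ []) distribute ⟩
  ⟦ y ∷ x ∷ v ⟧ ⊕ ((((X ◃ A ⊕ X ◃ B) ⊕ C) ⊕ D) ⊕ Δ) ⊖ ⟦ x ∷ x ∷ v ⟧ ⊕ []
    ≈⟨ solve 7 (λ yv a b c d δ p → ((yv ⊞ ((((a ⊞ b) ⊞ c) ⊞ d) ⊞ δ)) ⊞ p) ⊞ ⊕-Solver.id
                                  ⊜ (((yv ⊞ (b ⊞ a)) ⊞ (c ⊞ p)) ⊞ d) ⊞ δ) ≋-refl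
         ⟦ y ∷ x ∷ v ⟧ (X ◃ A) (X ◃ B) C D Δ (⊝ ⟦ x ∷ x ∷ v ⟧) ⟩
  ⟦ y ∷ x ∷ v ⟧ ⊕ (X ◃ B ⊕ X ◃ A) ⊕ (C ⊖ ⟦ x ∷ x ∷ v ⟧) ⊕ D ⊕ Δ
    ≈⟨ ⊕-congʳ Δ (⊕-congʳ D (⊕-cong (≡⇒≋ (cong (⟦ y ∷ x ∷ v ⟧ ⊕_) (sym (splitSum-step m w))))
                                   (subtract-once-more (suc m) (x ∷ x ∷ v)))) ⟩
  y⧢z-expansion (suc (suc m)) w ∎
  where
  open import Relation.Binary.Reasoning.Setoid ≋-setoid
  X : Word
  X = x ∷ []
  v : Word
  v = z (suc m) ++ w
  A B C D Δ : Poly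
  A = ⟦ z 1 ++ z (suc m) ++ w ⟧
  B = splitSum (suc m) w
  C = ⊝ (ℕ→ℚ (suc m) · ⟦ x ∷ x ∷ v ⟧)
  D = z (suc (suc m)) ◃ y⧢ w
  Δ = ⊝ δ· w (z (suc (suc (suc m))))
  distribute : X ◃ y⧢z-expansion (suc m) w ≡ (((X ◃ A ⊕ X ◃ B) ⊕ C) ⊕ D) ⊕ Δ
  distribute =
    trans (◃-⊕ X _ (⊝ δ· w (z (suc (suc m)))))
      (cong₂ _⊕_ (trans (◃-⊕ X _ (z (suc m) ◃ y⧢ w))
                   (cong₂ _⊕_ (trans (◃-⊕ X (A ⊕ B) _) (cong (_⊕ C) (◃-⊕ X A B)))
                              (◃-◃ X (z (suc m)) (y⧢ w))))
                 (◃-⊝δ· X w (z (suc (suc m)))))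

y⧢z-nonempty : ∀ k → 1 ≤ k → ∀ w → w ≢ [] →
  y⧢ (z k ++ w) ≋ ⟦ z 1 ++ z k ++ w ⟧ ⊕ splitSum k w ⊖ ℕ→ℚ k · ⟦ z (suc k) ++ w ⟧ ⊕ z k ◃ y⧢ w
y⧢z-nonempty k 1≤k [] w≢[] = ⊥-elim (w≢[] refl)
y⧢z-nonempty k 1≤k w@(_ ∷ _) _ = ≋-trans (y⧢z k 1≤k w) (≡⇒≋ (LP.++-identityʳ _))

-- Part (i) for w = 1: y ⧢ 1 = z₁, and the boundary term raises −k to −(k+1).
y⧢z-empty : ∀ k → 1 ≤ k →
  y⧢ (z k ++ []) ≋ ⟦ z 1 ++ z k ⟧ ⊕ Σ< (k ∸ 1) (λ j → ⟦ z (k ∸ j) ++ z (suc j) ⟧)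
                   ⊖ ℕ→ℚ (suc k) · ⟦ z (suc k) ⟧ ⊕ ⟦ z k ++ z 1 ⟧
y⧢z-empty k 1≤k = begin
  y⧢ (z k ++ [])
    ≈⟨ y⧢z k 1≤k [] ⟩
  y⧢z-expansion k []
    ≡⟨ cong₂ (λ a c → ⟦ z 1 ++ a ⟧ ⊕ splitSum k [] ⊖ ℕ→ℚ k · ⟦ c ⟧ ⊕ D ⊖ E)
             (LP.++-identityʳ (z k)) (LP.++-identityʳ (z (suc k))) ⟩
  A ⊕ splitSum k [] ⊕ C ⊕ D ⊕ ⊝ E
    ≡⟨ cong (λ b → A ⊕ b ⊕ C ⊕ D ⊕ ⊝ E)
            (Σ<-cong (k ∸ 1) λ j _ →
               cong (λ t → ⟦ z (k ∸ j) ++ t ⟧) (LP.++-identityʳ (z (suc j)))) ⟩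
  A ⊕ B ⊕ C ⊕ D ⊕ ⊝ E
    ≈⟨ solve 5 (λ a b c d e → (((a ⊞ b) ⊞ c) ⊞ d) ⊞ e ⊜ ((a ⊞ b) ⊞ (c ⊞ e)) ⊞ d) ≋-refl
         A B C D (⊝ E) ⟩
  A ⊕ B ⊕ (C ⊖ E) ⊕ D
    ≈⟨ ⊕-congʳ D (⊕-congˡ (A ⊕ B) (subtract-once-more k (z (suc k)))) ⟩
  A ⊕ B ⊖ ℕ→ℚ (suc k) · ⟦ z (suc k) ⟧ ⊕ D ∎
  where
  open import Relation.Binary.Reasoning.Setoid ≋-setoid
  A B C D E : Poly
  A = ⟦ z 1 ++ z k ⟧
  B = Σ< (k ∸ 1) (λ j → ⟦ z (k ∸ j) ++ z (suc j) ⟧)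
  C = ⊝ (ℕ→ℚ k · ⟦ z (suc k) ⟧)
  D = ⟦ z k ++ z 1 ⟧
  E = ⟦ z (suc k) ⟧

δK-suc : ∀ m i → δK (suc m) (suc i) ≡ δK m i
δK-suc m i with suc m ℕ.≟ suc i | m ℕ.≟ i
... | yes _ | yes _ = refl
... | no _ | no _ = refl
... | yes 1+m≡1+i | no m≢i = ⊥-elim (m≢i (ℕP.suc-injective 1+m≡1+i))
... | no 1+m≢1+i | yes m≡i = ⊥-elim (1+m≢1+i (cong suc m≡i))

zfrom-shift : ∀ ks a r → zfrom ks (suc a) r ≡ zfrom (ks ∘ suc) a r
zfrom-shift ks a zero = refl
zfrom-shift ks a (suc r) = cong (z (ks (suc a)) ++_) (zfrom-shift ks (suc a) r)

zseg-shift : ∀ ks a b → zseg ks (suc a) (suc b) ≡ zseg (ks ∘ suc) a b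
zseg-shift ks a b = zfrom-shift ks a (suc b ∸ a)

peel-word : ∀ ks i a n (M : Word → Word) →
  zseg ks 1 (suc i) ++ M (zseg ks (suc a) (suc n))
    ≡ z (ks 1) ++ zseg (ks ∘ suc) 1 i ++ M (zseg (ks ∘ suc) a n)
peel-word ks i a n M = trans (LP.++-assoc (z (ks 1)) (zfrom ks 2 i) _)
  (cong₂ (λ u v → z (ks 1) ++ u ++ M v) (zfrom-shift ks 1 i) (zseg-shift ks a n))

insertion : ℕ → (ℕ → ℕ) → ℕ → Poly
insertion n ks i = ⟦ zseg ks 1 i ++ z 1 ++ zseg ks (suc i) n ⟧

splitting : ℕ → (ℕ → ℕ) → ℕ → ℕ → Poly
splitting n ks i′ j =
  ⟦ zseg ks 1 i′ ++ z (ks (suc i′) ∸ j) ++ z (suc j) ++ zseg ks (suc (suc i′)) n ⟧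

raising : ℕ → (ℕ → ℕ) → ℕ → Poly
raising n ks i′ = ℕ→ℚ (ks (suc i′) + δK n (suc i′))
  · ⟦ zseg ks 1 i′ ++ z (suc (ks (suc i′))) ++ zseg ks (suc (suc i′)) n ⟧

insertions splittings raisings : ℕ → (ℕ → ℕ) → Poly
insertions n ks = Σ< (suc n) (insertion n ks)
splittings n ks = Σ< n (λ i′ → Σ< (ks (suc i′) ∸ 1) (splitting n ks i′))
raisings n ks = Σ< n (raising n ks)

insertions-peel : ∀ n ks →
  insertions (suc n) ks ≡ ⟦ z 1 ++ zseg ks 1 (suc n) ⟧ ⊕ z (ks 1) ◃ insertions n (ks ∘ suc)
insertions-peel n ks = Σ<-peel (suc n) (insertion (suc n) ks) (insertion n (ks ∘ suc)) λ i _ →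
  cong ⟦_⟧ (peel-word ks i (suc i) n (z 1 ++_))

splittings-peel : ∀ n ks →
  splittings (suc n) ks ≡ splitSum (ks 1) (zseg ks 2 (suc n)) ⊕ z (ks 1) ◃ splittings n (ks ∘ suc)
splittings-peel n ks =
  Σ<-peel n (λ i′ → Σ< (ks (suc i′) ∸ 1) (splitting (suc n) ks i′))
            (λ i′ → Σ< (ks (2 + i′) ∸ 1) (splitting n (ks ∘ suc) i′)) λ i _ →
  Σ<-◃ (ks (2 + i) ∸ 1) (splitting (suc n) ks (suc i)) (splitting n (ks ∘ suc) i) λ j _ →
  cong ⟦_⟧ (peel-word ks i (suc (suc i)) n (λ t → z (ks (2 + i) ∸ j) ++ z (suc j) ++ t))

raisings-peel : ∀ n ks →
  raisings (suc n) ks ≡ ℕ→ℚ (ks 1 + δK (suc n) 1) · ⟦ z (suc (ks 1)) ++ zseg ks 2 (suc n) ⟧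
                        ⊕ z (ks 1) ◃ raisings n (ks ∘ suc)
raisings-peel n ks = Σ<-peel n (raising (suc n) ks) (raising n (ks ∘ suc)) λ i _ →
  cong₂ (λ d t → ℕ→ℚ (ks (2 + i) + d) · ⟦ t ⟧)
        (δK-suc n (suc i)) (peel-word ks i (suc (suc i)) n (z (suc (ks (2 + i))) ++_))

-- The boundary term of (y⧢z) for w = z_{k₂} ⋯ z_{k_{n+1}} supplies δ_{n+1,1}.
raising-boundary : ∀ c ks a n t →
  ⊝ (ℕ→ℚ c · ⟦ t ++ zfrom ks a n ⟧) ⊖ δ· (zfrom ks a n) t
    ≋ ⊝ (ℕ→ℚ (c + δK (suc n) 1) · ⟦ t ++ zfrom ks a n ⟧)
raising-boundary c ks a zero t = begin
  ⊝ (ℕ→ℚ c · ⟦ t ++ [] ⟧) ⊖ ⟦ t ⟧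
    ≡⟨ cong (λ u → ⊝ (ℕ→ℚ c · ⟦ u ⟧) ⊖ ⟦ t ⟧) (LP.++-identityʳ t) ⟩
  ⊝ (ℕ→ℚ c · ⟦ t ⟧) ⊖ ⟦ t ⟧
    ≈⟨ subtract-once-more c t ⟩
  ⊝ (ℕ→ℚ (suc c) · ⟦ t ⟧)
    ≡⟨ cong₂ (λ d u → ⊝ (ℕ→ℚ d · ⟦ u ⟧)) (ℕP.+-comm 1 c) (sym (LP.++-identityʳ t)) ⟩
  ⊝ (ℕ→ℚ (c + 1) · ⟦ t ++ [] ⟧) ∎
  where open import Relation.Binary.Reasoning.Setoid ≋-setoid
raising-boundary c ks a (suc n) t = ≡⇒≋ (begin
  ⊝ (ℕ→ℚ c · ⟦ t ++ W ⟧) ⊖ δ· W t   ≡⟨ cong (λ d → ⊝ (ℕ→ℚ c · ⟦ t ++ W ⟧) ⊖ d) (δ·-z (ks a) _ t) ⟩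
  ⊝ (ℕ→ℚ c · ⟦ t ++ W ⟧) ⊕ []       ≡⟨ LP.++-identityʳ _ ⟩
  ⊝ (ℕ→ℚ c · ⟦ t ++ W ⟧)            ≡⟨ cong (λ d → ⊝ (ℕ→ℚ d · ⟦ t ++ W ⟧)) (ℕP.+-identityʳ c) ⟨
  ⊝ (ℕ→ℚ (c + 0) · ⟦ t ++ W ⟧)      ∎)
  where
  open ≡-Reasoning
  W : Word
  W = zfrom ks a (suc n)

y⧢zseg : ∀ n ks → (∀ i → 1 ≤ i → i ≤ n → 1 ≤ ks i) →
  y⧢ (zseg ks 1 n) ≋ insertions n ks ⊕ splittings n ks ⊖ raisings n ks
y⧢zseg zero ks _ = ≋-refl
y⧢zseg (suc n) ks pos = begin
  y⧢ (z k ++ W)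
    ≈⟨ y⧢z k (pos 1 ℕP.≤-refl (s≤s z≤n)) W ⟩
  A ⊕ B ⊕ C ⊕ z k ◃ y⧢ W ⊕ Δ
    ≈⟨ ⊕-congʳ Δ (⊕-congˡ (A ⊕ B ⊕ C) (◃-cong (z k) shorter)) ⟩
  A ⊕ B ⊕ C ⊕ z k ◃ (I ⊕ S ⊖ R) ⊕ Δ
    ≡⟨ cong (λ p → A ⊕ B ⊕ C ⊕ p ⊕ Δ) distribute ⟩
  A ⊕ B ⊕ C ⊕ (z k ◃ I ⊕ z k ◃ S ⊖ z k ◃ R) ⊕ Δ
    ≈⟨ solve 7 (λ a b c i s r δ → (((a ⊞ b) ⊞ c) ⊞ ((i ⊞ s) ⊞ r)) ⊞ δ
                                ⊜ ((a ⊞ i) ⊞ (b ⊞ s)) ⊞ ((c ⊞ δ) ⊞ r)) ≋-refl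
         A B C (z k ◃ I) (z k ◃ S) (⊝ (z k ◃ R)) Δ ⟩
  (A ⊕ z k ◃ I) ⊕ (B ⊕ z k ◃ S) ⊕ ((C ⊕ Δ) ⊖ z k ◃ R)
    ≈⟨ ⊕-congˡ ((A ⊕ z k ◃ I) ⊕ (B ⊕ z k ◃ S))
         (⊕-congʳ (⊝ (z k ◃ R)) (raising-boundary k ks 2 n (z (suc k)))) ⟩
  (A ⊕ z k ◃ I) ⊕ (B ⊕ z k ◃ S) ⊕ (⊝ first-raising ⊖ z k ◃ R)
    ≡⟨ cong₂ _⊕_ (sym (cong₂ _⊕_ (insertions-peel n ks) (splittings-peel n ks)))
                 (sym (trans (cong ⊝_ (raisings-peel n ks)) (⊝-⊕ first-raising (z k ◃ R)))) ⟩
  insertions (suc n) ks ⊕ splittings (suc n) ks ⊖ raisings (suc n) ks ∎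
  where
  open import Relation.Binary.Reasoning.Setoid ≋-setoid
  k : ℕ
  k = ks 1
  ks′ : ℕ → ℕ
  ks′ = ks ∘ suc
  W : Word
  W = zseg ks 2 (suc n)
  A B C Δ I S R : Poly
  A = ⟦ z 1 ++ z k ++ W ⟧
  B = splitSum k W
  C = ⊝ (ℕ→ℚ k · ⟦ z (suc k) ++ W ⟧)
  Δ = ⊝ δ· W (z (suc k))
  I = insertions n ks′
  S = splittings n ks′
  R = raisings n ks′
  first-raising : Poly
  first-raising = ℕ→ℚ (k + δK (suc n) 1) · ⟦ z (suc k) ++ W ⟧
  shorter : y⧢ W ≋ I ⊕ S ⊖ R
  shorter = ≋-trans (≡⇒≋ (cong y⧢_ (zseg-shift ks 1 n)))
    (y⧢zseg n ks′ λ i 1≤i i≤n → pos (suc i) (s≤s z≤n) (s≤s i≤n))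
  distribute : z k ◃ (I ⊕ S ⊖ R) ≡ z k ◃ I ⊕ z k ◃ S ⊖ z k ◃ R
  distribute = trans (◃-⊕ (z k) (I ⊕ S) (⊝ R)) (cong₂ _⊕_ (◃-⊕ (z k) I S) (◃-⊝ (z k) R))

-- Lemma 3.2.  (i) is (y⧢z) split by w = 1 / w ≠ 1; (ii) is y⧢zseg, which
-- does not need the hypothesis n ≥ 1.
lemma3p2 :
    -- (i)
    ((w : Word) (k : ℕ) → 1 ≤ k →
      (w ≡ [] →
        nsh (y ∷ []) (z k ++ w)
          ≈ ⟦ z 1 ++ z k ⟧
            ⊕ Σ< (k ∸ 1) (λ j → ⟦ z (k ∸ j) ++ z (suc j) ⟧)
            ⊖ ℕ→ℚ (suc k) · ⟦ z (suc k) ⟧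
            ⊕ ⟦ z k ++ z 1 ⟧)
      × (w ≢ [] →
        nsh (y ∷ []) (z k ++ w)
          ≈ ⟦ z 1 ++ z k ++ w ⟧
            ⊕ Σ< (k ∸ 1) (λ j → ⟦ z (k ∸ j) ++ z (suc j) ++ w ⟧)
            ⊖ ℕ→ℚ k · ⟦ z (suc k) ++ w ⟧
            ⊕ z k ◃ nsh (y ∷ []) w))
    ×
    -- (ii)
    ((n : ℕ) → 1 ≤ n → (ks : ℕ → ℕ) → (∀ i → 1 ≤ i → i ≤ n → 1 ≤ ks i) →
      nsh (y ∷ []) (zseg ks 1 n)
        ≈ Σ< (suc n) (λ i → ⟦ zseg ks 1 i ++ z 1 ++ zseg ks (suc i) n ⟧)
          ⊕ Σ< n (λ i′ → Σ< (ks (suc i′) ∸ 1) (λ j →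
              ⟦ zseg ks 1 i′ ++ z (ks (suc i′) ∸ j) ++ z (suc j) ++ zseg ks (suc (suc i′)) n ⟧))
          ⊖ Σ< n (λ i′ → ℕ→ℚ (ks (suc i′) + δK n (suc i′))
              · ⟦ zseg ks 1 i′ ++ z (suc (ks (suc i′))) ++ zseg ks (suc (suc i′)) n ⟧))
lemma3p2 =
  (λ w k 1≤k → (λ { refl → coeffs (y⧢z-empty k 1≤k) })
             , (λ w≢[] → coeffs (y⧢z-nonempty k 1≤k w w≢[])))
  , (λ n _ ks positive → coeffs (y⧢zseg n ks positive))
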